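{- Let $t\geq 2$ be an integer and let $K_{1,t-1}$ be the star with $t$ vertices. Then $M_{K_{1,t-1}}(n)\leq t-1$ for every $n$.
   Context: For graphs $H$ and $G$, let $n_H(G)$ be the number of copies of $H$ in $G$. The $H$-process on a graph $G$ is the sequence $(G_i)_{i\geq0}$ with $G_0=G$, $V(G_i)=V(G)$ and $E(G_i)=E(G_{i-1})\cup\{e\in\binom{V(G)}{2}: n_H(G_{i-1}+e)>n_H(G_{i-1})\}$ for $i\ge1$. The running time is $\tau_H(G)=\min\{t\in\mathbb N: G_t=G_{t+1}\}$, and $M_H(n)=\max\{\tau_H(G): |V(G)|=n\}$. -}

module Defs where

open import Data.Nat using (ℕ; zero; suc; _<ᵇ_; _<_)
open import Data.Bool using (Bool; true; false; _∧_; _∨_; not; _xor_)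
open import Data.Fin using (Fin; zero; suc)
open import Data.Fin.Properties using (_≟_)
open import Data.List using (List; []; _∷_; map; concatMap; length; filterᵇ; allFin; cartesianProduct)
open import Data.Bool.ListAction using (all; any)
open import Data.Vec using (Vec; lookup) renaming ([] to []ᵥ; _∷_ to _∷ᵥ_)
open import Data.Product using (_×_; _,_)
open import Relation.Nullary using (¬_; does)
open import Relation.Binary.PropositionalEquality using (_≡_)

_⇒ᵇ_ : Bool → Bool → Bool
a ⇒ᵇ b = not a ∨ b

_⇔ᵇ_ : Bool → Bool → Bool
a ⇔ᵇ b = not (a xor b)

_==_ : ∀ {n} → Fin n → Fin n → Bool
i == j = does (i ≟ j)

∀F : ∀ {n} → (Fin n → Bool) → Bool
∀F {n} p = all p (allFin n)

∃F : ∀ {n} → (Fin n → Bool) → Bool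
∃F {n} p = any p (allFin n)

allVec : ∀ {A : Set} → List A → (m : ℕ) → List (Vec A m)
allVec xs zero    = []ᵥ ∷ []
allVec xs (suc m) = concatMap (λ x → map (x ∷ᵥ_) (allVec xs m)) xs

bools : List Bool
bools = true ∷ false ∷ []

-- Graphs on vertex set Fin n.
-- A function G : Fin n → Fin n → Bool represents the simple graph with
-- edge set { {i,j} : i ≠ j and (G i j or G j i) }  (see Edge).

Graph : ℕ → Set
Graph n = Fin n → Fin n → Bool

Edge : ∀ {n} → Graph n → Fin n → Fin n → Bool
Edge G i j = not (i == j) ∧ (G i j ∨ G j i)

SameGraph : ∀ {n} → Graph n → Graph n → Set
SameGraph G G' = ∀ i j → Edge G i j ≡ Edge G' i j

addEdge : ∀ {n} → Graph n → Fin n → Fin n → Graph n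
addEdge G x y a b = G a b ∨ (a == x ∧ b == y)

-- Copies of H in G: subgraphs (U, F) of G (U a vertex subset, F a
-- symmetric irreflexive edge set with F ⊆ E(G) and F ⊆ (U choose 2))
-- isomorphic to H.

Mat : ℕ → Set
Mat n = Vec (Vec Bool n) n

at : ∀ {n} → Mat n → Fin n → Fin n → Bool
at F i j = lookup (lookup F i) j

isSubgraph : ∀ {n} → Graph n → Vec Bool n → Mat n → Bool
isSubgraph G U F = ∀F λ i → ∀F λ j →
  ((at F i j ⇔ᵇ at F j i) ∧ not (at F i i))
  ∧ (at F i j ⇒ᵇ Edge G i j)
  ∧ (at F i j ⇒ᵇ (lookup U i ∧ lookup U j))

isIsoTo : ∀ {h n} → Graph h → Vec Bool n → Mat n → Bool
isIsoTo {h} {n} H U F = any ok (allVec (allFin n) h)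
  where
  ok : Vec (Fin n) h → Bool
  ok φ = (∀F λ a → ∀F λ b → (lookup φ a == lookup φ b) ⇒ᵇ (a == b))
       ∧ (∀F λ v → lookup U v ⇔ᵇ (∃F λ a → lookup φ a == v))
       ∧ (∀F λ a → ∀F λ b → Edge H a b ⇔ᵇ at F (lookup φ a) (lookup φ b))

nCopies : ∀ {h n} → Graph h → Graph n → ℕ
nCopies {h} {n} H G =
  length (filterᵇ (λ { (U , F) → isSubgraph G U F ∧ isIsoTo H U F })
                  (cartesianProduct (allVec bools n) (allVec (allVec bools n) n)))

step : ∀ {h n} → Graph h → Graph n → Graph n
step H G a b = Edge G a b ∨ (not (a == b) ∧ (nCopies H G <ᵇ nCopies H (addEdge G a b)))

process : ∀ {h n} → Graph h → Graph n → ℕ → Graph n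
process H G zero    = G
process H G (suc k) = step H (process H G k)

IsRunningTime : ∀ {h n} → Graph h → Graph n → ℕ → Set
IsRunningTime H G τ =
  SameGraph (process H G τ) (process H G (suc τ))
  × (∀ s → s < τ → ¬ SameGraph (process H G s) (process H G (suc s)))

isZero : ∀ {t} → Fin t → Bool
isZero zero    = true
isZero (suc _) = false

star : (t : ℕ) → Graph t
star t a b = isZero a ∨ isZero b

{-# OPTIONS --safe #-}
-- Write t = d + 2. Adding a non-edge xy to G creates a new copy of K_{1,d+1} exactly when x or y
-- already has degree at least d: a new copy must use xy, every edge of a star is a spoke, so x or y
-- is its centre; conversely, if x has d neighbours, they and y are the leaves of a new star centred
-- at x. Hence whenever the process does not stop, some endpoint of a newly added edge had degree at
-- least d without being universal, and it becomes universal in the next graph. If the first d steps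
-- all change the graph, G_d has d universal vertices, every other vertex has degree at least d, so
-- G_{d+1} is complete and the process has stopped by time d + 1 = t - 1.
module Submission where

open import Defs
open import Data.Bool using (Bool; true; false; T; not; _∧_; _∨_)
open import Data.Bool.Properties using (T-∧; T-∨; T?) renaming (_≟_ to _≟ᵇ_)
open import Data.Empty using (⊥-elim)
open import Data.Fin using (Fin; zero; suc; punchIn)
open import Data.Fin.Properties using (_≟_; all?; any?; ¬∀⟶∃¬; suc-injective; punchIn-injective; punchInᵢ≢i)
open import Data.List using (List; _∷_; length; filterᵇ; allFin; map; cartesianProduct)
open import Data.List.Membership.Propositional using (_∈_)
open import Data.List.Membership.Propositional.Properties
  using (∈-allFin; ∈-concatMap⁺; ∈-map⁺; ∈-cartesianProduct⁺)
open import Data.List.Relation.Unary.All as All using (All; []; _∷_)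
open import Data.List.Relation.Unary.All.Properties using (all⁺; all⁻; ¬Any⇒All¬)
open import Data.List.Relation.Unary.Any as Any using (Any; here; there)
open import Data.List.Relation.Unary.Any.Properties using (any⁺; any⁻)
open import Data.Nat using (ℕ; zero; suc; _≤_; _<_; _∸_; _<ᵇ_; z≤n; s≤s; s≤s⁻¹)
open import Data.Nat.Properties
  using (≤-refl; ≤-trans; <⇒≤; <-≤-trans; m≤n⇒m≤1+n; m<n⇒m<1+n; n<1+n; <⇒≱; <ᵇ⇒<; <⇒<ᵇ; anyUpTo?)
import Data.Product as Product
open import Data.Product using (∃; ∃₂; ∃-syntax; _×_; _,_; proj₁; proj₂)
open import Data.Sum as Sum using (_⊎_; inj₁; inj₂)
open import Data.Unit using (tt)
open import Data.Vec using (Vec; lookup; tabulate) renaming ([] to []ᵥ; _∷_ to _∷ᵥ_)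
open import Data.Vec.Properties using (lookup∘tabulate)
import Data.Vec.Functional as Vector
open import Function using (_∘_; const)
open import Function.Definitions using (Injective)
open import Function.Bundles using (_⇔_; mk⇔; module Equivalence)
open import Function.Construct.Composition using (_⇔-∘_)
import Function.Properties.Equivalence as ⇔
open import Data.Product.Function.NonDependent.Propositional using (_×-⇔_)
open import Data.Sum.Function.Propositional using (_⊎-⇔_)
open import Relation.Nullary using (¬_; Dec; yes; no; contradiction; _×-dec_; _⊎-dec_; ¬?)
open import Relation.Nullary.Decidable as Dec using (isYes; toWitness; fromWitness)
open import Relation.Binary.PropositionalEquality using (_≡_; _≢_; refl; sym; trans; cong; cong₂; subst)

open Equivalence using (to; from)

T-not : ∀ {b} → T (not b) ⇔ (¬ T b)
T-not {true}  = mk⇔ (λ ()) (λ ¬t → ¬t tt)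
T-not {false} = mk⇔ (λ _ ()) (const tt)

T-⇒ᵇ : ∀ {a b} → T (a ⇒ᵇ b) ⇔ (T a → T b)
T-⇒ᵇ {true}  = mk⇔ const (λ f → f tt)
T-⇒ᵇ {false} = mk⇔ (λ _ ()) (const tt)

T-⇔ᵇ : ∀ {a b} → T (a ⇔ᵇ b) ⇔ (a ≡ b)
T-⇔ᵇ {true}  {true}  = mk⇔ (const refl) (const tt)
T-⇔ᵇ {true}  {false} = mk⇔ (λ ()) (λ ())
T-⇔ᵇ {false} {true}  = mk⇔ (λ ()) (λ ())
T-⇔ᵇ {false} {false} = mk⇔ (const refl) (const tt)

⇔⇒≡ : ∀ {a b} → (T a ⇔ T b) → a ≡ b
⇔⇒≡ {true}  {true}  _ = refl
⇔⇒≡ {true}  {false} e = ⊥-elim (to e tt)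
⇔⇒≡ {false} {true}  e = ⊥-elim (from e tt)
⇔⇒≡ {false} {false} _ = refl

T-== : ∀ {n} {i j : Fin n} → T (i == j) ⇔ (i ≡ j)
T-== {i = i} {j} with i ≟ j
... | yes i≡j = mk⇔ (const i≡j) (const tt)
... | no  i≢j = mk⇔ (λ ()) i≢j

T-∀F : ∀ {n} {p : Fin n → Bool} → T (∀F p) ⇔ (∀ i → T (p i))
T-∀F {n} {p} = mk⇔ (λ t i → All.lookup (all⁺ p (allFin n) t) (∈-allFin i))
                   (λ f → all⁻ p {allFin n} (All.tabulate (λ {i} _ → f i)))

T-∀F² : ∀ {n} {p : Fin n → Fin n → Bool} → T (∀F λ i → ∀F (p i)) ⇔ (∀ i j → T (p i j))
T-∀F² {p = p} = mk⇔ (λ t i → to (T-∀F {p = p i}) (to T-∀F t i))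
                    (λ f → from T-∀F λ i → from (T-∀F {p = p i}) (f i))

T-∃F : ∀ {n} {p : Fin n → Bool} → T (∃F p) ⇔ ∃ (T ∘ p)
T-∃F {n} {p} = mk⇔ (λ t → Any.satisfied (any⁻ p (allFin n) t))
                   (λ (i , t) → any⁺ p (Any.map (λ { refl → t }) (∈-allFin i)))

∈-allVec : ∀ {A : Set} {xs : List A} → (∀ x → x ∈ xs) → ∀ {m} (v : Vec A m) → v ∈ allVec xs m
∈-allVec complete []ᵥ       = here refl
∈-allVec {xs = xs} complete (x ∷ᵥ v) =
  ∈-concatMap⁺ (λ y → map (y ∷ᵥ_) (allVec xs _))
               (Any.map (λ { refl → ∈-map⁺ (x ∷ᵥ_) (∈-allVec complete v) }) (complete x))

∈-bools : ∀ b → b ∈ bools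
∈-bools true  = here refl
∈-bools false = there (here refl)


module _ {A : Set} where

  filterᵇ-length-≤ : ∀ {p q : A → Bool} {xs} → All (λ x → T (p x) → T (q x)) xs →
    length (filterᵇ p xs) ≤ length (filterᵇ q xs)
  filterᵇ-length-≤ []                = z≤n
  filterᵇ-length-≤ {p} {q} {x ∷ _} (p⇒q ∷ ps) with p x | q x
  ... | true  | true  = s≤s (filterᵇ-length-≤ ps)
  ... | true  | false = ⊥-elim (p⇒q tt)
  ... | false | true  = m≤n⇒m≤1+n (filterᵇ-length-≤ ps)
  ... | false | false = filterᵇ-length-≤ ps

  filterᵇ-length-< : ∀ {p q : A → Bool} {xs} → All (λ x → T (p x) → T (q x)) xs →
    Any (λ x → T (q x) × ¬ T (p x)) xs → length (filterᵇ p xs) < length (filterᵇ q xs)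
  filterᵇ-length-< {p} {q} {x ∷ _} (p⇒q ∷ ps) (here (qx , ¬px)) with p x | q x
  ... | true  | _     = ⊥-elim (¬px tt)
  ... | false | true  = s≤s (filterᵇ-length-≤ ps)
  filterᵇ-length-< {p} {q} {x ∷ _} (p⇒q ∷ ps) (there w) with p x | q x
  ... | true  | true  = s≤s (filterᵇ-length-< ps w)
  ... | true  | false = ⊥-elim (p⇒q tt)
  ... | false | true  = m≤n⇒m≤1+n (filterᵇ-length-< ps w)
  ... | false | false = filterᵇ-length-< ps w

  filterᵇ-length-<⇒Any : ∀ {p q : A → Bool} xs → length (filterᵇ p xs) < length (filterᵇ q xs) →
    Any (λ x → T (q x) × ¬ T (p x)) xs
  filterᵇ-length-<⇒Any {p} {q} xs p<q with Any.any? (λ x → T? (q x) ×-dec ¬? (T? (p x))) xs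
  ... | yes w = w
  ... | no ¬w = contradiction (filterᵇ-length-≤ (All.map q⇒p (¬Any⇒All¬ xs ¬w))) (<⇒≱ p<q)
    where
    q⇒p : ∀ {x} → ¬ (T (q x) × ¬ T (p x)) → T (q x) → T (p x)
    q⇒p {x} ¬new qx with T? (p x)
    ... | yes px = px
    ... | no ¬px = contradiction (qx , ¬px) ¬new

∷-injective-fresh : ∀ {A : Set} {k} {x : A} {f : Fin k → A} → Injective _≡_ _≡_ f → (∀ i → x ≢ f i) →
  Injective _≡_ _≡_ (x Vector.∷ f)
∷-injective-fresh f-inj fresh {zero}  {zero}  _ = refl
∷-injective-fresh f-inj fresh {zero}  {suc j} e = contradiction e (fresh j)
∷-injective-fresh f-inj fresh {suc i} {zero}  e = contradiction (sym e) (fresh i)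
∷-injective-fresh f-inj fresh {suc i} {suc j} e = cong suc (f-inj e)

module _ {n : ℕ} where

  record Adjacent (G : Graph n) (i j : Fin n) : Set where
    constructor adjacent
    field
      distinct : i ≢ j
      edge     : T (G i j) ⊎ T (G j i)

  T-Edge : ∀ {G : Graph n} {i j} → T (Edge G i j) ⇔ Adjacent G i j
  T-Edge {G} {i} {j} = mk⇔
    (λ t → let ne , e = to (T-∧ {not (i == j)}) t in adjacent (to T-not ne ∘ from T-==) (to (T-∨ {G i j}) e))
    (λ (adjacent i≢j e) → from (T-∧ {not (i == j)}) (from T-not (i≢j ∘ to T-==) , from (T-∨ {G i j}) e))

  Adjacent-irrefl : ∀ {G : Graph n} {i} → ¬ Adjacent G i i
  Adjacent-irrefl adj = Adjacent.distinct adj refl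

  Adjacent-sym : ∀ {G : Graph n} {i j} → Adjacent G i j → Adjacent G j i
  Adjacent-sym (adjacent i≢j e) = adjacent (i≢j ∘ sym) (Sum.swap e)

  Adjacent? : ∀ (G : Graph n) i j → Dec (Adjacent G i j)
  Adjacent? G i j = Dec.map T-Edge (T? (Edge G i j))

  T-addEdge : ∀ {G : Graph n} {x y a b} → T (addEdge G x y a b) ⇔ (T (G a b) ⊎ (a ≡ x × b ≡ y))
  T-addEdge {G} {x} {y} {a} {b} = mk⇔
    (λ t → Sum.map₂ (λ e → let a≡x , b≡y = to (T-∧ {a == x}) e in to T-== a≡x , to T-== b≡y)
                    (to (T-∨ {G a b}) t))
    (from (T-∨ {G a b}) ∘ Sum.map₂ (λ (a≡x , b≡y) → from (T-∧ {a == x}) (from T-== a≡x , from T-== b≡y)))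

  addEdge-adjacent⁺ : ∀ {G : Graph n} {x y i j} → Adjacent G i j → Adjacent (addEdge G x y) i j
  addEdge-adjacent⁺ {G} {x} {y} {i} {j} (adjacent i≢j e) =
    adjacent i≢j (Sum.map (from (T-addEdge {G} {x} {y}) ∘ inj₁) (from (T-addEdge {G} {x} {y}) ∘ inj₁) e)

  addEdge-adjacent-new : ∀ {G : Graph n} {x y} → x ≢ y → Adjacent (addEdge G x y) x y
  addEdge-adjacent-new {G} {x} {y} x≢y = adjacent x≢y (inj₁ (from (T-addEdge {G} {x} {y}) (inj₂ (refl , refl))))

  addEdge-adjacent⁻ : ∀ {G : Graph n} {x y i j} → Adjacent (addEdge G x y) i j →
    Adjacent G i j ⊎ (i ≡ x × j ≡ y ⊎ i ≡ y × j ≡ x)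
  addEdge-adjacent⁻ {G} {x} {y} (adjacent i≢j e)
    with Sum.map (to (T-addEdge {G} {x} {y})) (to (T-addEdge {G} {x} {y})) e
  ... | inj₁ (inj₁ g)             = inj₁ (adjacent i≢j (inj₁ g))
  ... | inj₂ (inj₁ g)             = inj₁ (adjacent i≢j (inj₂ g))
  ... | inj₁ (inj₂ (i≡x , j≡y)) = inj₂ (inj₁ (i≡x , j≡y))
  ... | inj₂ (inj₂ (j≡x , i≡y)) = inj₂ (inj₂ (i≡y , j≡x))

  addEdge-new-neighbour-unique : ∀ {G : Graph n} {x y u a b} →
    Adjacent (addEdge G x y) u a → ¬ Adjacent G u a →
    Adjacent (addEdge G x y) u b → ¬ Adjacent G u b → a ≡ b
  addEdge-new-neighbour-unique ua ¬ua ub ¬ub with addEdge-adjacent⁻ ua | addEdge-adjacent⁻ ub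
  ... | inj₁ old                  | _                         = contradiction old ¬ua
  ... | inj₂ _                    | inj₁ old                  = contradiction old ¬ub
  ... | inj₂ (inj₁ (refl , refl)) | inj₂ (inj₁ (_ , refl))    = refl
  ... | inj₂ (inj₂ (refl , refl)) | inj₂ (inj₂ (_ , refl))    = refl
  ... | inj₂ (inj₁ (refl , _))    | inj₂ (inj₂ (refl , refl)) = contradiction ub Adjacent-irrefl
  ... | inj₂ (inj₂ (refl , _))    | inj₂ (inj₁ (refl , refl)) = contradiction ub Adjacent-irrefl

  record DegreeAtLeast (d : ℕ) (G : Graph n) (u : Fin n) : Set where
    constructor neighbours
    field
      neighbour           : Fin d → Fin n
      neighbour-injective : Injective _≡_ _≡_ neighbour
      neighbour-adjacent  : ∀ i → Adjacent G u (neighbour i)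

  degree-addEdge⁺ : ∀ {G : Graph n} {d x y} → DegreeAtLeast d G x → x ≢ y → ¬ Adjacent G x y →
    DegreeAtLeast (suc d) (addEdge G x y) x
  degree-addEdge⁺ {G} {d} {x} {y} (neighbours v v-inj v-adj) x≢y ¬xy =
    neighbours (y Vector.∷ v) (∷-injective-fresh v-inj y≢v) λ where
      zero    → addEdge-adjacent-new x≢y
      (suc i) → addEdge-adjacent⁺ (v-adj i)
    where
    y≢v : ∀ i → y ≢ v i
    y≢v i y≡vi = ¬xy (subst (Adjacent G x) (sym y≡vi) (v-adj i))

  degree-addEdge⁻ : ∀ {G : Graph n} {d x y u} → DegreeAtLeast (suc d) (addEdge G x y) u → DegreeAtLeast d G u
  degree-addEdge⁻ {G} {d} {x} {y} {u} (neighbours v v-inj v-adj) with all? (λ i → Adjacent? G u (v i))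
  ... | yes old = neighbours (v ∘ suc) (suc-injective ∘ v-inj) (old ∘ suc)
  ... | no ¬old with ¬∀⟶∃¬ _ _ (λ i → Adjacent? G u (v i)) ¬old
  ...   | q , ¬uvq = neighbours (v ∘ punchIn q) (punchIn-injective q _ _ ∘ v-inj) adj
    where
    adj : ∀ i → Adjacent G u (v (punchIn q i))
    adj i with Adjacent? G u (v (punchIn q i))
    ... | yes old = old
    ... | no ¬new = contradiction (v-inj (addEdge-new-neighbour-unique (v-adj _) ¬new (v-adj q) ¬uvq))
                                  (punchInᵢ≢i q i)

  Universal : Graph n → Fin n → Set
  Universal G u = ∀ {z} → u ≢ z → Adjacent G u z

  record UniversalVertices (k : ℕ) (G : Graph n) : Set where
    constructor universals
    field
      vertex           : Fin k → Fin n
      vertex-injective : Injective _≡_ _≡_ vertex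
      vertex-universal : ∀ i → Universal G (vertex i)

  Complete : Graph n → Set
  Complete G = ∀ {a b} → a ≢ b → Adjacent G a b

  record IsSubgraph (G : Graph n) (U : Vec Bool n) (F : Mat n) : Set where
    field
      symmetric   : ∀ i j → at F i j ≡ at F j i
      irreflexive : ∀ i → ¬ T (at F i i)
      edges⊆      : ∀ {i j} → T (at F i j) → Adjacent G i j
      vertices⊆   : ∀ {i j} → T (at F i j) → T (lookup U i) × T (lookup U j)

  T-isSubgraph : ∀ {G U F} → T (isSubgraph G U F) ⇔ IsSubgraph G U F
  T-isSubgraph {G} {U} {F} = mk⇔ toRecord fromRecord
    where
    sym? edge? vertices? : Fin n → Fin n → Bool
    sym? i j      = at F i j ⇔ᵇ at F j i
    edge? i j     = at F i j ⇒ᵇ Edge G i j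
    vertices? i j = at F i j ⇒ᵇ (lookup U i ∧ lookup U j)

    conditions : Fin n → Fin n → Bool
    conditions i j = (sym? i j ∧ not (at F i i)) ∧ (edge? i j ∧ vertices? i j)

    Conditions : Fin n → Fin n → Set
    Conditions i j = (T (sym? i j) × T (not (at F i i))) × (T (edge? i j) × T (vertices? i j))

    T-conditions : ∀ {i j} → T (conditions i j) ⇔ Conditions i j
    T-conditions {i} {j} = (T-∧ {sym? i j} ×-⇔ T-∧ {edge? i j}) ⇔-∘ T-∧ {sym? i j ∧ not (at F i i)}

    holds : T (isSubgraph G U F) → ∀ i j → Conditions i j
    holds t i j = to T-conditions (to (T-∀F² {p = conditions}) t i j)

    toRecord : T (isSubgraph G U F) → IsSubgraph G U F
    toRecord t = record
      { symmetric   = λ i j → to T-⇔ᵇ (proj₁ (proj₁ (holds t i j)))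
      ; irreflexive = λ i → to T-not (proj₂ (proj₁ (holds t i i)))
      ; edges⊆      = λ {i} {j} f → to T-Edge (to T-⇒ᵇ (proj₁ (proj₂ (holds t i j))) f)
      ; vertices⊆   = λ {i} {j} f → to (T-∧ {lookup U i}) (to T-⇒ᵇ (proj₂ (proj₂ (holds t i j))) f)
      }

    fromRecord : IsSubgraph G U F → T (isSubgraph G U F)
    fromRecord s = from (T-∀F² {p = conditions}) λ i j → from T-conditions
        ( (from T-⇔ᵇ (symmetric i j) , from T-not (irreflexive i))
        , (from T-⇒ᵇ (from T-Edge ∘ edges⊆) , from T-⇒ᵇ (from (T-∧ {lookup U i}) ∘ vertices⊆)) )
      where open IsSubgraph s

  record IsIsomorphicTo {h} (H : Graph h) (U : Vec Bool n) (F : Mat n) : Set where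
    field
      embedding : Fin h → Fin n
      injective : Injective _≡_ _≡_ embedding
      image     : ∀ w → T (lookup U w) ⇔ (∃[ a ] embedding a ≡ w)
      preserves : ∀ a b → Edge H a b ≡ at F (embedding a) (embedding b)

  T-isIsoTo : ∀ {h} {H : Graph h} {U F} → T (isIsoTo H U F) ⇔ IsIsomorphicTo H U F
  T-isIsoTo {h} {H} {U} {F} = mk⇔ toRecord fromRecord
    where
    injective? preserves? : Vec (Fin n) h → Fin h → Fin h → Bool
    injective? φ a b = (lookup φ a == lookup φ b) ⇒ᵇ (a == b)
    preserves? φ a b = Edge H a b ⇔ᵇ at F (lookup φ a) (lookup φ b)

    image? : Vec (Fin n) h → Fin n → Bool
    image? φ w = lookup U w ⇔ᵇ (∃F λ a → lookup φ a == w)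

    ok : Vec (Fin n) h → Bool
    ok φ = (∀F λ a → ∀F (injective? φ a)) ∧ (∀F (image? φ)) ∧ (∀F λ a → ∀F (preserves? φ a))

    image⇔ : ∀ {φ w} → lookup U w ≡ (∃F λ a → lookup φ a == w) → T (lookup U w) ⇔ (∃[ a ] lookup φ a ≡ w)
    image⇔ {φ} {w} e = mk⇔
      (λ u → let a , t = to T-∃F (subst T e u) in a , to T-== t)
      (λ (a , φa≡w) → subst T (sym e) (from (T-∃F {p = λ a → lookup φ a == w}) (a , from T-== φa≡w)))

    toRecord : T (isIsoTo H U F) → IsIsomorphicTo H U F
    toRecord t with Any.satisfied (any⁻ ok (allVec (allFin n) h) t)
    ... | φ , okφ = record
      { embedding = lookup φ
      ; injective = λ {a} {b} e → to T-== (to T-⇒ᵇ (to (T-∀F² {p = injective? φ}) inj a b) (from T-== e))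
      ; image     = λ w → image⇔ {φ} (to T-⇔ᵇ (to (T-∀F {p = image? φ}) img w))
      ; preserves = λ a b → to T-⇔ᵇ (to (T-∀F² {p = preserves? φ}) pres a b)
      }
      where
      inj = proj₁ (to (T-∧ {∀F λ a → ∀F (injective? φ a)}) okφ)
      img = proj₁ (to (T-∧ {∀F (image? φ)}) (proj₂ (to (T-∧ {∀F λ a → ∀F (injective? φ a)}) okφ)))
      pres = proj₂ (to (T-∧ {∀F (image? φ)}) (proj₂ (to (T-∧ {∀F λ a → ∀F (injective? φ a)}) okφ)))

    fromRecord : IsIsomorphicTo H U F → T (isIsoTo H U F)
    fromRecord iso = any⁺ ok (Any.map (λ { refl → okφ }) (∈-allVec ∈-allFin φ))
      where
      open IsIsomorphicTo iso
      φ : Vec (Fin n) h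
      φ = tabulate embedding
      lookup-φ : ∀ a → lookup φ a ≡ embedding a
      lookup-φ = lookup∘tabulate embedding
      image-φ : ∀ {w} → T (∃F λ a → lookup φ a == w) ⇔ (∃[ a ] embedding a ≡ w)
      image-φ = mk⇔ (λ t → let a , φa≡w = to T-∃F t in a , trans (sym (lookup-φ a)) (to T-== φa≡w))
                    (λ (a , e) → from T-∃F (a , from T-== (trans (lookup-φ a) e)))
      okφ : T (ok φ)
      okφ = from (T-∧ {∀F λ a → ∀F (injective? φ a)})
        ( from (T-∀F² {p = injective? φ}) (λ a b → from T-⇒ᵇ λ t →
            from T-== (injective (trans (sym (lookup-φ a)) (trans (to T-== t) (lookup-φ b)))))
        , from (T-∧ {∀F (image? φ)})
            ( from T-∀F (λ w → from T-⇔ᵇ (⇔⇒≡ (⇔.sym image-φ ⇔-∘ image w)))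
            , from (T-∀F² {p = preserves? φ}) (λ a b → from T-⇔ᵇ
                (trans (preserves a b) (sym (cong₂ (at F) (lookup-φ a) (lookup-φ b))))) ) )

  IsSubgraph-mono : ∀ {G₁ G₂ : Graph n} {U F} → (∀ {i j} → Adjacent G₁ i j → Adjacent G₂ i j) →
    IsSubgraph G₁ U F → IsSubgraph G₂ U F
  IsSubgraph-mono G₁⊆G₂ s = record
    { symmetric = symmetric ; irreflexive = irreflexive ; edges⊆ = G₁⊆G₂ ∘ edges⊆ ; vertices⊆ = vertices⊆ }
    where open IsSubgraph s

  IsCopy : ∀ {h} → Graph h → Graph n → Vec Bool n × Mat n → Set
  IsCopy H G (U , F) = IsSubgraph G U F × IsIsomorphicTo H U F

  T-isCopy : ∀ {h} {H : Graph h} {G : Graph n} {U F} →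
    T (isSubgraph G U F ∧ isIsoTo H U F) ⇔ IsCopy H G (U , F)
  T-isCopy {G = G} {U} {F} = (T-isSubgraph ×-⇔ T-isIsoTo) ⇔-∘ T-∧ {isSubgraph G U F}

  candidates : List (Vec Bool n × Mat n)
  candidates = cartesianProduct (allVec bools n) (allVec (allVec bools n) n)

  ∈-candidates : ∀ c → c ∈ candidates
  ∈-candidates (U , F) = ∈-cartesianProduct⁺ (∈-allVec ∈-bools U) (∈-allVec (∈-allVec ∈-bools) F)

  nCopies-< : ∀ {h} {H : Graph h} {G₁ G₂ : Graph n} → (∀ {i j} → Adjacent G₁ i j → Adjacent G₂ i j) →
    ∀ c → IsCopy H G₂ c → ¬ IsCopy H G₁ c → nCopies H G₁ < nCopies H G₂
  nCopies-< {H = H} {G₁} {G₂} G₁⊆G₂ c new ¬old = filterᵇ-length-<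
    (All.tabulate λ { {U , F} _ → from (T-isCopy {H = H} {G₂} {U} {F})
                                  ∘ Product.map₁ (IsSubgraph-mono G₁⊆G₂) ∘ to (T-isCopy {H = H} {G₁} {U} {F}) })
    (Any.map (λ { {U , F} refl → from (T-isCopy {H = H} {G₂} {U} {F}) new
                               , ¬old ∘ to (T-isCopy {H = H} {G₁} {U} {F}) })
             (∈-candidates c))

  nCopies-<⇒newCopy : ∀ {h} {H : Graph h} {G₁ G₂ : Graph n} → nCopies H G₁ < nCopies H G₂ →
    ∃ λ c → IsCopy H G₂ c × ¬ IsCopy H G₁ c
  nCopies-<⇒newCopy {H = H} {G₁} {G₂} G₁<G₂ with Any.satisfied (filterᵇ-length-<⇒Any candidates G₁<G₂)
  ... | (U , F) , new , ¬old =
    (U , F) , to (T-isCopy {H = H} {G₂} {U} {F}) new , ¬old ∘ from (T-isCopy {H = H} {G₁} {U} {F})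

  IsSubgraph-addEdge⁻ : ∀ {G : Graph n} {x y U F} → IsSubgraph (addEdge G x y) U F → ¬ T (at F x y) →
    IsSubgraph G U F
  IsSubgraph-addEdge⁻ {G} {x} {y} {U} {F} s ¬Fxy = record
    { symmetric = symmetric ; irreflexive = irreflexive ; edges⊆ = old ; vertices⊆ = vertices⊆ }
    where
    open IsSubgraph s
    old : ∀ {i j} → T (at F i j) → Adjacent G i j
    old Fij with addEdge-adjacent⁻ (edges⊆ Fij)
    ... | inj₁ adj                 = adj
    ... | inj₂ (inj₁ (refl , refl)) = contradiction Fij ¬Fxy
    ... | inj₂ (inj₂ (refl , refl)) = contradiction (subst T (symmetric y x) Fij) ¬Fxy

T-isZero : ∀ {t} {k : Fin (suc t)} → T (isZero k) ⇔ (k ≡ zero)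
T-isZero {k = zero}  = mk⇔ (const refl) (const tt)
T-isZero {k = suc _} = mk⇔ (λ ()) (λ ())

Adjacent-star⇔ : ∀ {t} {k l : Fin (suc t)} → Adjacent (star (suc t)) k l ⇔ (k ≢ l × (k ≡ zero ⊎ l ≡ zero))
Adjacent-star⇔ {t} {k} {l} = mk⇔
  (λ (adjacent k≢l e) → k≢l , Sum.[ centre {k} {l} , Sum.swap ∘ centre {l} {k} ] e)
  (λ (k≢l , c) → adjacent k≢l (inj₁ (from (T-∨ {isZero k}) (Sum.map (from T-isZero) (from T-isZero) c))))
  where
  centre : ∀ {k l : Fin (suc t)} → T (isZero k ∨ isZero l) → k ≡ zero ⊎ l ≡ zero
  centre {k} = Sum.map (to T-isZero) (to T-isZero) ∘ to (T-∨ {isZero k})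

at-tabulate : ∀ {n} (f : Fin n → Fin n → Bool) i j → at (tabulate λ i → tabulate (f i)) i j ≡ f i j
at-tabulate f i j = trans (cong (λ row → lookup row j) (lookup∘tabulate _ i)) (lookup∘tabulate (f i) j)

module StarAt {n t} {G : Graph n} {a : Fin n} (deg : DegreeAtLeast t G a) where

  open DegreeAtLeast deg

  φ : Fin (suc t) → Fin n
  φ = a Vector.∷ neighbour

  neighbour≢a : ∀ l → neighbour l ≢ a
  neighbour≢a l e = Adjacent-irrefl (subst (Adjacent G a) e (neighbour-adjacent l))

  φ-injective : Injective _≡_ _≡_ φ
  φ-injective = ∷-injective-fresh neighbour-injective λ l → neighbour≢a l ∘ sym

  InImage : Fin n → Set
  InImage w = ∃[ k ] φ k ≡ w

  Spoke : Fin n → Fin n → Set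
  Spoke i j = ∃[ l ] ((i ≡ a × j ≡ neighbour l) ⊎ (i ≡ neighbour l × j ≡ a))

  U : Vec Bool n
  U = tabulate λ w → isYes (any? λ k → φ k ≟ w)

  F : Mat n
  F = tabulate λ i → tabulate λ j →
        isYes (any? λ l → ((i ≟ a) ×-dec (j ≟ neighbour l)) ⊎-dec ((i ≟ neighbour l) ×-dec (j ≟ a)))

  T-U : ∀ {w} → T (lookup U w) ⇔ InImage w
  T-U {w} = mk⇔ (toWitness ∘ subst T (lookup∘tabulate _ w))
                (subst T (sym (lookup∘tabulate _ w)) ∘ fromWitness)

  T-F : ∀ {i j} → T (at F i j) ⇔ Spoke i j
  T-F {i} {j} = mk⇔ (toWitness ∘ subst T (at-tabulate _ i j))
                    (subst T (sym (at-tabulate _ i j)) ∘ fromWitness)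

  Spoke-sym : ∀ {i j} → Spoke i j → Spoke j i
  Spoke-sym (l , e) = l , Sum.swap (Sum.map Product.swap Product.swap e)

  Spoke-irrefl : ∀ {i} → ¬ Spoke i i
  Spoke-irrefl (l , inj₁ (refl , e)) = neighbour≢a l (sym e)
  Spoke-irrefl (l , inj₂ (e , refl)) = neighbour≢a l (sym e)

  Spoke-adjacent : ∀ {i j} → Spoke i j → Adjacent G i j
  Spoke-adjacent (l , inj₁ (refl , refl)) = neighbour-adjacent l
  Spoke-adjacent (l , inj₂ (refl , refl)) = Adjacent-sym (neighbour-adjacent l)

  Spoke-inImage : ∀ {i j} → Spoke i j → InImage i × InImage j
  Spoke-inImage (l , inj₁ (refl , refl)) = (zero , refl) , (suc l , refl)
  Spoke-inImage (l , inj₂ (refl , refl)) = (suc l , refl) , (zero , refl)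

  star⇒Spoke : ∀ {p q} → p ≢ q × (p ≡ zero ⊎ q ≡ zero) → Spoke (φ p) (φ q)
  star⇒Spoke {zero}  {zero}  (p≢q , _) = contradiction refl p≢q
  star⇒Spoke {zero}  {suc l} _         = l , inj₁ (refl , refl)
  star⇒Spoke {suc l} {zero}  _         = l , inj₂ (refl , refl)
  star⇒Spoke {suc _} {suc _} (_ , inj₁ ())
  star⇒Spoke {suc _} {suc _} (_ , inj₂ ())

  Spoke⇒star : ∀ {p q} → Spoke (φ p) (φ q) → p ≢ q × (p ≡ zero ⊎ q ≡ zero)
  Spoke⇒star {p} {q} (l , inj₁ (φp≡a , φq≡l))
    with φ-injective {p} {zero} φp≡a | φ-injective {q} {suc l} φq≡l
  ... | refl | refl = (λ ()) , inj₁ refl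
  Spoke⇒star {p} {q} (l , inj₂ (φp≡l , φq≡a))
    with φ-injective {p} {suc l} φp≡l | φ-injective {q} {zero} φq≡a
  ... | refl | refl = (λ ()) , inj₂ refl

  Adjacent-star⇔Spoke : ∀ {p q} → Adjacent (star (suc t)) p q ⇔ Spoke (φ p) (φ q)
  Adjacent-star⇔Spoke = mk⇔ star⇒Spoke Spoke⇒star ⇔-∘ Adjacent-star⇔

  subgraph : IsSubgraph G U F
  subgraph = record
    { symmetric   = λ i j → ⇔⇒≡ (⇔.sym T-F ⇔-∘ (mk⇔ Spoke-sym Spoke-sym ⇔-∘ T-F))
    ; irreflexive = λ i → Spoke-irrefl ∘ to T-F
    ; edges⊆      = Spoke-adjacent ∘ to T-F
    ; vertices⊆   = Product.map (from T-U) (from T-U) ∘ Spoke-inImage ∘ to T-F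
    }

  isomorphic : IsIsomorphicTo (star (suc t)) U F
  isomorphic = record
    { embedding = φ
    ; injective = φ-injective
    ; image     = λ w → T-U
    ; preserves = λ p q → ⇔⇒≡ (⇔.sym T-F ⇔-∘ (Adjacent-star⇔Spoke {p} {q} ⇔-∘ T-Edge))
    }

  spoke : ∀ l → T (at F a (neighbour l))
  spoke l = from T-F (l , inj₁ (refl , refl))

module _ {n : ℕ} where

  centre-degree : ∀ {t} {G : Graph n} {U F} → IsSubgraph G U F → (iso : IsIsomorphicTo (star (suc t)) U F) →
    DegreeAtLeast t G (IsIsomorphicTo.embedding iso zero)
  centre-degree {t} s iso = neighbours (embedding ∘ suc) (suc-injective ∘ injective) λ l →
    edges⊆ (subst T (preserves zero (suc l))
                    (from T-Edge (from (Adjacent-star⇔ {t} {zero} {suc l}) ((λ ()) , inj₁ refl))))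
    where
    open IsSubgraph s
    open IsIsomorphicTo iso

  nCopies-star-< : ∀ {t} {G : Graph n} {a b} → DegreeAtLeast t G a → a ≢ b → ¬ Adjacent G a b →
    nCopies (star (suc (suc t))) G < nCopies (star (suc (suc t))) (addEdge G a b)
  nCopies-star-< deg a≢b ¬ab =
    nCopies-< addEdge-adjacent⁺ (U , F) (subgraph , isomorphic)
              λ (s , _) → ¬ab (IsSubgraph.edges⊆ s (spoke zero))
    where open StarAt (degree-addEdge⁺ deg a≢b ¬ab)

  nCopies-star-<⇒degree : ∀ {t} {G : Graph n} {x y} →
    nCopies (star (suc (suc t))) G < nCopies (star (suc (suc t))) (addEdge G x y) →
    DegreeAtLeast t G x ⊎ DegreeAtLeast t G y
  nCopies-star-<⇒degree {t} {G} {x} {y} more with nCopies-<⇒newCopy more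
  ... | (U , F) , (s , iso) , ¬old = Sum.map (centre-at x∈) (centre-at y∈) x∨y-is-centre
    where
    open IsSubgraph s
    open IsIsomorphicTo iso
    Fxy : T (at F x y)
    Fxy with T? (at F x y)
    ... | yes f  = f
    ... | no ¬f = contradiction (IsSubgraph-addEdge⁻ s ¬f , iso) ¬old
    x∈ : ∃[ p ] embedding p ≡ x
    x∈ = to (image x) (proj₁ (vertices⊆ Fxy))
    y∈ : ∃[ q ] embedding q ≡ y
    y∈ = to (image y) (proj₂ (vertices⊆ Fxy))
    x∨y-is-centre : proj₁ x∈ ≡ zero ⊎ proj₁ y∈ ≡ zero
    x∨y-is-centre = proj₂ (to Adjacent-star⇔ (to T-Edge
      (subst T (sym (trans (preserves _ _) (cong₂ (at F) (proj₂ x∈) (proj₂ y∈)))) Fxy)))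
    centre-at : ∀ {w} → ((r , _) : ∃[ r ] embedding r ≡ w) → r ≡ zero → DegreeAtLeast t G w
    centre-at (_ , φr≡w) refl = subst (DegreeAtLeast t G) φr≡w (degree-addEdge⁻ (centre-degree s iso))

module _ {n h : ℕ} (H : Graph h) where

  T-step : ∀ {G : Graph n} {a b} →
    T (step H G a b) ⇔ (Adjacent G a b ⊎ (a ≢ b × nCopies H G < nCopies H (addEdge G a b)))
  T-step {G} {a} {b} = (T-Edge ⊎-⇔ mk⇔ growing⇒ ⇒growing) ⇔-∘ T-∨ {Edge G a b}
    where
    growing⇒ : T (not (a == b) ∧ (nCopies H G <ᵇ nCopies H (addEdge G a b))) →
      a ≢ b × nCopies H G < nCopies H (addEdge G a b)
    growing⇒ t = let a≠b , more = to (T-∧ {not (a == b)}) t in to T-not a≠b ∘ from T-== , <ᵇ⇒< _ _ more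
    ⇒growing : a ≢ b × nCopies H G < nCopies H (addEdge G a b) →
      T (not (a == b) ∧ (nCopies H G <ᵇ nCopies H (addEdge G a b)))
    ⇒growing (a≢b , more) = from (T-∧ {not (a == b)}) (from T-not (a≢b ∘ to T-==) , <⇒<ᵇ more)

  step-adjacent⁺ : ∀ {G : Graph n} {a b} → Adjacent G a b → Adjacent (step H G) a b
  step-adjacent⁺ {G} adj = adjacent (Adjacent.distinct adj) (inj₁ (from (T-step {G}) (inj₁ adj)))

  step-adjacent-< : ∀ {G : Graph n} {a b} → a ≢ b → nCopies H G < nCopies H (addEdge G a b) →
    Adjacent (step H G) a b
  step-adjacent-< {G} a≢b more = adjacent a≢b (inj₁ (from (T-step {G}) (inj₂ (a≢b , more))))

  step-adjacent⁻ : ∀ {G : Graph n} {a b} → Adjacent (step H G) a b → ¬ Adjacent G a b →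
    nCopies H G < nCopies H (addEdge G a b) ⊎ nCopies H G < nCopies H (addEdge G b a)
  step-adjacent⁻ {G} (adjacent _ e) ¬ab with Sum.map (to (T-step {G})) (to (T-step {G})) e
  ... | inj₁ (inj₁ ab)          = contradiction ab ¬ab
  ... | inj₂ (inj₁ ba)          = contradiction (Adjacent-sym ba) ¬ab
  ... | inj₁ (inj₂ (_ , more)) = inj₁ more
  ... | inj₂ (inj₂ (_ , more)) = inj₂ more

  step-changed⇒newEdge : ∀ {G : Graph n} → ¬ SameGraph G (step H G) →
    ∃₂ λ a b → ¬ Adjacent G a b × Adjacent (step H G) a b
  step-changed⇒newEdge {G} changed
    with ¬∀⟶∃¬ n _ (λ i → all? λ j → Edge G i j ≟ᵇ Edge (step H G) i j) changed
  ... | a , changed-at-a with ¬∀⟶∃¬ n _ (λ j → Edge G a j ≟ᵇ Edge (step H G) a j) changed-at-a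
  ...   | b , changed-ab with T? (Edge G a b) | T? (Edge (step H G) a b)
  ...     | yes ab | _
            = contradiction (⇔⇒≡ (mk⇔ (from T-Edge ∘ step-adjacent⁺ {G} ∘ to T-Edge) (const ab))) changed-ab
  ...     | no ¬ab | yes ab⁺ = a , b , ¬ab ∘ from T-Edge , to T-Edge ab⁺
  ...     | no ¬ab | no ¬ab⁺ = contradiction (⇔⇒≡ (mk⇔ (⊥-elim ∘ ¬ab) (⊥-elim ∘ ¬ab⁺))) changed-ab

  complete⇒stable : ∀ {G : Graph n} → Complete G → SameGraph G (step H G)
  complete⇒stable {G} complete i j =
    ⇔⇒≡ (mk⇔ (from T-Edge ∘ step-adjacent⁺ {G} ∘ to T-Edge)
              (from T-Edge ∘ complete ∘ Adjacent.distinct ∘ to (T-Edge {G = step H G})))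

  Stable : Graph n → ℕ → Set
  Stable G s = SameGraph (process H G s) (process H G (suc s))

  Stable? : ∀ G s → Dec (Stable G s)
  Stable? G s = all? λ i → all? λ j → Edge (process H G s) i j ≟ᵇ Edge (process H G (suc s)) i j

-- S is K_{1,t+1}: the theorem's t is t + 2 here, and t is the degree threshold.
module _ {n t : ℕ} where

  S : Graph (suc (suc t))
  S = star (suc (suc t))

  star-step-new : ∀ {G : Graph n} {a b} → Adjacent (step S G) a b → ¬ Adjacent G a b →
    DegreeAtLeast t G a ⊎ DegreeAtLeast t G b
  star-step-new {G} {a} {b} ab⁺ ¬ab with step-adjacent⁻ S ab⁺ ¬ab
  ... | inj₁ more = nCopies-star-<⇒degree {t = t} {G} {a} {b} more
  ... | inj₂ more = Sum.swap (nCopies-star-<⇒degree {t = t} {G} {b} {a} more)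

  star-step-saturates : ∀ {G : Graph n} {a b} → DegreeAtLeast t G a → a ≢ b → Adjacent (step S G) a b
  star-step-saturates {G} {a} {b} deg a≢b with Adjacent? G a b
  ... | yes ab = step-adjacent⁺ S ab
  ... | no ¬ab = step-adjacent-< S {G} a≢b (nCopies-star-< deg a≢b ¬ab)

  extend-universal : ∀ {k} {G : Graph n} {w} →
    UniversalVertices k G → DegreeAtLeast t G w → ¬ Universal G w → UniversalVertices (suc k) (step S G)
  extend-universal {k} {G} {w} (universals u u-inj u-univ) deg ¬univ =
    universals (w Vector.∷ u) (∷-injective-fresh u-inj w≢u) λ where
      zero    → star-step-saturates deg
      (suc i) → step-adjacent⁺ S ∘ u-univ i
    where
    w≢u : ∀ i → w ≢ u i
    w≢u i refl = ¬univ (u-univ i)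

  universal-step : ∀ {k} {G : Graph n} → UniversalVertices k G → ¬ SameGraph G (step S G) →
    UniversalVertices (suc k) (step S G)
  universal-step univ changed =
    let a , b , ¬ab , ab⁺ = step-changed⇒newEdge S changed
        a≢b = Adjacent.distinct ab⁺
    in Sum.[ (λ deg → extend-universal univ deg λ a-univ → ¬ab (a-univ a≢b))
           , (λ deg → extend-universal univ deg λ b-univ → ¬ab (Adjacent-sym (b-univ (a≢b ∘ sym)))) ]
           (star-step-new ab⁺ ¬ab)

  universal⇒complete : ∀ {G : Graph n} → UniversalVertices t G → Complete (step S G)
  universal⇒complete {G} (universals u u-inj u-univ) {a} {b} a≢b with Adjacent? G a b
  ... | yes ab = step-adjacent⁺ S ab
  ... | no ¬ab = star-step-saturates (neighbours u u-inj λ i → Adjacent-sym (u-univ i (a≢u i ∘ sym))) a≢b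
    where
    a≢u : ∀ i → a ≢ u i
    a≢u i refl = ¬ab (u-univ i a≢b)

  stable-or-universal : ∀ (G : Graph n) k →
    (∃[ s ] s < k × Stable S G s) ⊎ UniversalVertices k (process S G k)
  stable-or-universal G zero = inj₂ (universals (λ ()) (λ { {()} }) (λ ()))
  stable-or-universal G (suc k) with stable-or-universal G k
  ... | inj₁ (s , s<k , stable) = inj₁ (s , m<n⇒m<1+n s<k , stable)
  ... | inj₂ univ with Stable? S G k
  ...   | yes stable  = inj₁ (k , n<1+n k , stable)
  ...   | no  ¬stable = inj₂ (universal-step univ ¬stable)

  stable-within : ∀ (G : Graph n) → ∃[ s ] s ≤ suc t × Stable S G s
  stable-within G with stable-or-universal G t
  ... | inj₁ (s , s<t , stable) = s , m≤n⇒m≤1+n (<⇒≤ s<t) , stable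
  ... | inj₂ univ               = suc t , ≤-refl , complete⇒stable S (universal⇒complete univ)

minimal : ∀ {P : ℕ → Set} → (∀ s → Dec (P s)) → ∀ {s} → P s →
  ∃[ m ] m ≤ s × P m × (∀ r → r < m → ¬ P r)
minimal {P} P? {s} ps = go s ≤-refl ps
  where
  go : ∀ N {s} → s ≤ N → P s → ∃[ m ] m ≤ s × P m × (∀ r → r < m → ¬ P r)
  go zero    z≤n  p0 = zero , z≤n , p0 , λ _ ()
  go (suc N) {s} s≤N ps with anyUpTo? P? s
  ... | no none = s , ≤-refl , ps , λ r r<s pr → none (r , r<s , pr)
  ... | yes (r , r<s , pr) with go N (s≤s⁻¹ (<-≤-trans r<s s≤N)) pr
  ...   | m , m≤r , pm , below = m , ≤-trans m≤r (<⇒≤ r<s) , pm , below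

mainTheorem7 : (t : ℕ) → 2 ≤ t → (n : ℕ) → (G : Graph n) →
    ∃[ τ ] (IsRunningTime (star t) G τ × τ ≤ t ∸ 1)
mainTheorem7 (suc (suc t)) (s≤s (s≤s _)) n G =
  let s , s≤1+t , stable = stable-within {t = t} G
      τ , τ≤s , stable-τ , unstable-before = minimal (Stable? (star (suc (suc t))) G) stable
  in τ , (stable-τ , unstable-before) , ≤-trans τ≤s s≤1+t
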